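{- Let $\pi$ be a pin-permutation of size $n$ written $\pi=\oplus[\pi_1,\dots,\pi_r]$ with $r\ge2$ and each $\pi_i$ $\oplus$-indecomposable, let $T_1,\dots,T_r$ be the corresponding sets of points of the diagram of $\pi$, and let $p=(p_1,\dots,p_n)$ be a pin representation of $\pi$. Then for every $k\in\{1,\dots,n\}$ there is at most one index $i$ such that the reading of $T_i$ has started but is not finished after $(p_1,\dots,p_k)$, i.e. such that $T_i$ contains both some point of $\{p_1,\dots,p_k\}$ and some point of $\{p_{k+1},\dots,p_n\}$.
   Context: For permutations $\pi_1,\dots,\pi_r$, $\oplus[\pi_1,\dots,\pi_r]$ is the permutation whose diagram consists of copies of the diagrams of $\pi_1,\dots,\pi_r$ placed in this order along an increasing diagonal (each copy entirely to the right of and above the previous one). A permutation is $\oplus$-indecomposable if it cannot be written as $\oplus[\tau_1,\dots,\tau_k]$ with $k\ge2$. A pin representation of $\pi$ is a sequence of points $(p_1,\dots,p_n)$, no two on a common horizontal or vertical line, order-isomorphic to the diagram of $\pi$ (we identify it with the diagram), such that each $p_i$ ($i\ge2$) lies outside the bounding box (smallest axis-parallel rectangle) of $\{p_1,\dots,p_{i-1}\}$ and either separates $p_{i-1}$ from $\{p_1,\dots,p_{i-2}\}$ (the horizontal or vertical line through $p_i$ has them on opposite sides) or does not separate $\{p_1,\dots,p_{i-1}\}$ into two nonempty sets. A pin-permutation is one having a pin representation. -}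

module Defs where

open import Data.Nat using (ℕ; zero; suc; _+_; _≤_; _<_)
open import Data.Fin using (Fin; toℕ; splitAt; _↑ˡ_; _↑ʳ_)
open import Data.Sum using (_⊎_; [_,_])
open import Data.Product using (Σ; _×_; ∃; proj₁; proj₂; _,_)
open import Data.List using (List; []; _∷_; length; take; lookup)
open import Data.List.Relation.Unary.All using (All)
open import Relation.Binary.PropositionalEquality using (_≡_)
open import Relation.Nullary using (¬_)
open import Function.Definitions using (Injective)

-- A permutation of size n is a bijection Fin n → Fin n (column ↦ value);
-- on a finite set injectivity suffices.  Its diagram is {(c, π c)}.
IsPerm : {n : ℕ} → (Fin n → Fin n) → Set
IsPerm π = Injective _≡_ _≡_ π

Block : Set
Block = Σ ℕ (λ m → Fin m → Fin m)

_⊕₂_ : {m k : ℕ} → (Fin m → Fin m) → (Fin k → Fin k) → Fin (m + k) → Fin (m + k)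
_⊕₂_ {m} {k} σ τ x = [ (λ a → σ a ↑ˡ k) , (λ b → m ↑ʳ τ b) ] (splitAt m x)

size : List Block → ℕ
size [] = zero
size (b ∷ bs) = proj₁ b + size bs

⊕[_] : (L : List Block) → Fin (size L) → Fin (size L)
⊕[ [] ] ()
⊕[ (m , σ) ∷ bs ] = σ ⊕₂ ⊕[ bs ]

IsNonemptyPerm : Block → Set
IsNonemptyPerm (m , σ) = (1 ≤ m) × IsPerm σ

IsOplusIndecomposable : {m : ℕ} → (Fin m → Fin m) → Set
IsOplusIndecomposable {m} σ =
  ¬ (Σ (List Block) λ L → (2 ≤ length L) × All IsNonemptyPerm L ×
       Σ (size L ≡ m) λ e → (∀ x → toℕ (σ x) ≡ toℕ (⊕[ L ] (Data.Fin.cast (Relation.Binary.PropositionalEquality.sym e) x))))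

-- Pin representations.  A pin representation of π is identified with an
-- ordering of the points of its diagram: p : Fin n → Fin n (bijective),
-- the k-th point being (p k , π (p k)).
module _ {n : ℕ} (π : Fin n → Fin n) (p : Fin n → Fin n) where

  X : Fin n → ℕ
  X k = toℕ (p k)

  Y : Fin n → ℕ
  Y k = toℕ (π (p k))

  OutsideBox : Fin n → Set
  OutsideBox i =
      (∀ j → toℕ j < toℕ i → X i < X j)
    ⊎ (∀ j → toℕ j < toℕ i → X j < X i)
    ⊎ (∀ j → toℕ j < toℕ i → Y i < Y j)
    ⊎ (∀ j → toℕ j < toℕ i → Y j < Y i)

  -- the vertical or horizontal line through point i has point i' (= i-1) on
  -- one side and all points of index < i' on the other side
  Separates : Fin n → Fin n → Set
  Separates i i' =
      (X i' < X i × (∀ j → toℕ j < toℕ i' → X i < X j))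
    ⊎ (X i < X i' × (∀ j → toℕ j < toℕ i' → X j < X i))
    ⊎ (Y i' < Y i × (∀ j → toℕ j < toℕ i' → Y i < Y j))
    ⊎ (Y i < Y i' × (∀ j → toℕ j < toℕ i' → Y j < Y i))

  DoesNotSeparate : Fin n → Set
  DoesNotSeparate i =
      ((∀ j → toℕ j < toℕ i → X j < X i) ⊎ (∀ j → toℕ j < toℕ i → X i < X j))
    × ((∀ j → toℕ j < toℕ i → Y j < Y i) ⊎ (∀ j → toℕ j < toℕ i → Y i < Y j))

  IsPinRepresentation : Set
  IsPinRepresentation =
    IsPerm p ×
    (∀ (i i' : Fin n) → toℕ i ≡ suc (toℕ i') →
       OutsideBox i × (Separates i i' ⊎ DoesNotSeparate i))

IsPinPermutation : {n : ℕ} → (Fin n → Fin n) → Set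
IsPinPermutation {n} π = IsPerm π × Σ (Fin n → Fin n) (IsPinRepresentation π)

-- the column c of the diagram of ⊕[L] lies in block i (i.e. the point
-- (c, ⊕[L] c) belongs to T_i)
InBlock : (L : List Block) → Fin (length L) → Fin (size L) → Set
InBlock L i c = size (take (toℕ i) L) ≤ toℕ c × toℕ c < size (take (toℕ i) L) + proj₁ (lookup L i)

-- after reading (p₁,…,p_k), T_i contains a read point and an unread point
-- (0-based indices: read points are those of index < k)
Straddles : (L : List Block) → (p : Fin (size L) → Fin (size L)) → ℕ → Fin (length L) → Set
Straddles L p k i =
    (∃ λ j → toℕ j < k × InBlock L i (p j))
  × (∃ λ j → k ≤ toℕ j × InBlock L i (p j))

-- Let blocks T_s, T_t with s < t both straddle k; T_s lies to the lower left of T_t.  Say the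
-- last pin ℓ_s of T_s comes before the last pin ℓ_t of T_t (otherwise argue in the diagram
-- turned by a half turn).  Every pin of T_t after ℓ_s has an earlier pin of T_s to its lower
-- left, and this rules out all pin conditions except two: the pin lies to the upper right of all
-- earlier pins, or its line separates its predecessor from them, and then the predecessor is in
-- T_t as well.  Walking back from ℓ_t we find i₀ > ℓ_s such that the pins i₀, …, ℓ_t lie to the
-- upper right of all earlier ones.  They are exactly the pins of T_t read from i₀ on, and some
-- pin of T_t is read before k; so T_t splits into a lower-left and an upper-right part, which
-- contradicts the ⊕-indecomposability of its pattern.
module Submission where

open import Defs hiding (OutsideBox; Separates; DoesNotSeparate)
open import Data.Nat using (ℕ; zero; suc; pred; _>_; >-nonZero; _+_; _∸_; _≤_; _<_; z≤n; s≤s; s≤s⁻¹; _≤?_; _<?_)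
open import Data.Nat.Properties
open import Data.Fin as Fin using (Fin; zero; suc; toℕ; fromℕ<; inject≤; cast; splitAt; _↑ˡ_; _↑ʳ_; punchOut)
open import Data.Fin.Properties
  using (toℕ-injective; toℕ<n; toℕ-fromℕ<; toℕ-inject≤; toℕ-cast; toℕ-↑ˡ; toℕ-↑ʳ;
         splitAt-↑ˡ; splitAt-↑ʳ; splitAt⁻¹-↑ˡ; splitAt⁻¹-↑ʳ; punchOut-injective; injective⇒≤; any?;
         fromℕ<-injective; inject≤-injective)
import Data.Fin.Properties as FinP
open import Data.Fin.Induction using (<-wellFounded)
open import Data.List using (List; []; _∷_; length; take; lookup)
open import Data.List.Relation.Unary.All as All using (All; []; _∷_)
open import Data.List.Membership.Propositional.Properties using (∈-lookup)
open import Data.Product using (_×_; ∃; proj₁; proj₂; _,_)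
import Data.Product as Product
open import Data.Sum using (_⊎_; inj₁; inj₂; swap; [_,_])
import Data.Sum as Sum
open import Data.Empty using (⊥; ⊥-elim)
open import Function.Definitions using (Injective)
open import Induction.WellFounded using (Acc; acc)
open import Relation.Binary using (Tri; tri<; tri≈; tri>)
open import Relation.Binary.Definitions using (Asymmetric)
open import Relation.Binary.PropositionalEquality hiding ([_])
open import Relation.Nullary using (¬_; yes; no)
open import Relation.Nullary.Decidable using (_×-dec_)
open import Relation.Unary using (Decidable)

injective⇒surjective : ∀ {n} {f : Fin n → Fin n} → Injective _≡_ _≡_ f → ∀ y → ∃ λ x → f x ≡ y
injective⇒surjective {f = f} f-inj y with any? (λ x → f x FinP.≟ y)
... | yes hit = hit
injective⇒surjective {suc n} {f} f-inj y | no miss = ⊥-elim (n≮n n (injective⇒≤ g-inj))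
  where
  y≢f : ∀ x → y ≢ f x
  y≢f x eq = miss (x , sym eq)
  g : Fin (suc n) → Fin n
  g x = punchOut (y≢f x)
  g-inj : Injective _≡_ _≡_ g
  g-inj eq = f-inj (punchOut-injective (y≢f _) (y≢f _) eq)

greatest : ∀ {n} (P : Fin n → Set) → Decidable P → ∃ P →
  ∃ λ i → P i × (∀ j → P j → toℕ j ≤ toℕ i)
greatest {suc n} P P? (j , Pj) with any? (λ x → P? (suc x))
... | yes later with greatest (λ x → P (suc x)) (λ x → P? (suc x)) later
...   | i , Pi , max = suc i , Pi , λ { zero _ → z≤n ; (suc l) Pl → s≤s (max l Pl) }
greatest {suc n} P P? (zero , P0) | no none = zero , P0 , λ { zero _ → z≤n ; (suc l) Pl → ⊥-elim (none (l , Pl)) }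
greatest {suc n} P P? (suc j , Pj) | no none = ⊥-elim (none (j , Pj))

predecessor : ∀ {n} (i : Fin n) → 0 < toℕ i → ∃ λ i' → toℕ i ≡ suc (toℕ i')
predecessor {n} i 0<i = fromℕ< m<n , (begin
  toℕ i                       ≡⟨ suc-pred (toℕ i) {{>-nonZero 0<i}} ⟨
  suc (pred (toℕ i))          ≡⟨ cong suc (toℕ-fromℕ< m<n) ⟨
  suc (toℕ (fromℕ< m<n))      ∎)
  where
  open ≡-Reasoning
  m<n : pred (toℕ i) < n
  m<n = ≤-<-trans pred[n]≤n (toℕ<n i)

↑-view : ∀ m {k} (y : Fin (m + k)) → (∃ λ a → a ↑ˡ k ≡ y) ⊎ (∃ λ b → m ↑ʳ b ≡ y)
↑-view m y with splitAt m y in eq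
... | inj₁ a = inj₁ (a , splitAt⁻¹-↑ˡ eq)
... | inj₂ b = inj₂ (b , splitAt⁻¹-↑ʳ eq)

toℕ-⊕₂-↑ˡ : ∀ {m k} (σ : Fin m → Fin m) (τ : Fin k → Fin k) (a : Fin m) →
  toℕ ((σ ⊕₂ τ) (a ↑ˡ k)) ≡ toℕ (σ a)
toℕ-⊕₂-↑ˡ {m} {k} σ τ a rewrite splitAt-↑ˡ m a k = toℕ-↑ˡ (σ a) k

toℕ-⊕₂-↑ʳ : ∀ {m k} (σ : Fin m → Fin m) (τ : Fin k → Fin k) (b : Fin k) →
  toℕ ((σ ⊕₂ τ) (m ↑ʳ b)) ≡ m + toℕ (τ b)
toℕ-⊕₂-↑ʳ {m} {k} σ τ b rewrite splitAt-↑ʳ m k b = toℕ-↑ʳ m (τ b)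

offset : (L : List Block) → Fin (length L) → ℕ
offset L i = size (take (toℕ i) L)

width : (L : List Block) → Fin (length L) → ℕ
width L i = proj₁ (lookup L i)

block : (L : List Block) (i : Fin (length L)) → Fin (width L i) → Fin (width L i)
block L i = proj₂ (lookup L i)

column : (L : List Block) (i : Fin (length L)) → Fin (width L i) → Fin (size L)
column ((m , σ) ∷ bs) zero    x = x ↑ˡ size bs
column ((m , σ) ∷ bs) (suc i) x = m ↑ʳ column bs i x

toℕ-column : ∀ L i x → toℕ (column L i x) ≡ offset L i + toℕ x
toℕ-column ((m , σ) ∷ bs) zero    x = toℕ-↑ˡ x (size bs)
toℕ-column ((m , σ) ∷ bs) (suc i) x = begin
  toℕ (m ↑ʳ column bs i x)       ≡⟨ toℕ-↑ʳ m (column bs i x) ⟩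
  m + toℕ (column bs i x)        ≡⟨ cong (m +_) (toℕ-column bs i x) ⟩
  m + (offset bs i + toℕ x)      ≡⟨ +-assoc m (offset bs i) (toℕ x) ⟨
  m + offset bs i + toℕ x        ∎
  where open ≡-Reasoning

toℕ-⊕-column : ∀ L i x → toℕ (⊕[ L ] (column L i x)) ≡ offset L i + toℕ (block L i x)
toℕ-⊕-column ((m , σ) ∷ bs) zero    x = toℕ-⊕₂-↑ˡ σ ⊕[ bs ] x
toℕ-⊕-column ((m , σ) ∷ bs) (suc i) x = begin
  toℕ ((σ ⊕₂ ⊕[ bs ]) (m ↑ʳ column bs i x))  ≡⟨ toℕ-⊕₂-↑ʳ σ ⊕[ bs ] (column bs i x) ⟩
  m + toℕ (⊕[ bs ] (column bs i x))          ≡⟨ cong (m +_) (toℕ-⊕-column bs i x) ⟩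
  m + (offset bs i + toℕ (block bs i x))     ≡⟨ +-assoc m (offset bs i) _ ⟨
  m + offset bs i + toℕ (block bs i x)       ∎
  where open ≡-Reasoning

inBlock-offset+ : ∀ L i (c : Fin (size L)) (x : Fin (width L i)) →
  toℕ c ≡ offset L i + toℕ x → InBlock L i c
inBlock-offset+ L i c x c≡ =
  subst (offset L i ≤_) (sym c≡) (m≤m+n (offset L i) (toℕ x)) ,
  subst (_< offset L i + width L i) (sym c≡) (+-monoʳ-< (offset L i) (toℕ<n x))

inBlock-column : ∀ L i x → InBlock L i (column L i x)
inBlock-column L i x = inBlock-offset+ L i _ x (toℕ-column L i x)

inBlock⇒column : ∀ L i c → InBlock L i c → ∃ λ x → column L i x ≡ c
inBlock⇒column L i c (off≤c , c<end) = fromℕ< c∸off<w , toℕ-injective (begin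
  toℕ (column L i (fromℕ< c∸off<w))   ≡⟨ toℕ-column L i _ ⟩
  offset L i + toℕ (fromℕ< c∸off<w)   ≡⟨ cong (offset L i +_) (toℕ-fromℕ< c∸off<w) ⟩
  offset L i + (toℕ c ∸ offset L i)   ≡⟨ m+[n∸m]≡n off≤c ⟩
  toℕ c                               ∎)
  where
  open ≡-Reasoning
  c∸off<w : toℕ c ∸ offset L i < width L i
  c∸off<w = subst (toℕ c ∸ offset L i <_) (m+n∸m≡n (offset L i) (width L i)) (∸-monoˡ-< c<end off≤c)

inBlock-⊕ : ∀ L i c → InBlock L i c → InBlock L i (⊕[ L ] c)
inBlock-⊕ L i c c∈i with inBlock⇒column L i c c∈i
... | x , refl = inBlock-offset+ L i _ (block L i x) (toℕ-⊕-column L i x)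

inSomeBlock : ∀ L c → ∃ λ i → InBlock L i c
inSomeBlock ((m , σ) ∷ bs) c with ↑-view m c
... | inj₁ (a , refl) = zero , z≤n , subst (_< m) (sym (toℕ-↑ˡ a (size bs))) (toℕ<n a)
... | inj₂ (b , refl) with inSomeBlock bs b
...   | i , off≤b , b<end = suc i ,
        subst (m + offset bs i ≤_) (sym (toℕ-↑ʳ m b)) (+-monoʳ-≤ m off≤b) ,
        subst (_< m + offset bs i + width bs i) (sym (toℕ-↑ʳ m b))
          (≤-trans (+-monoʳ-< m b<end) (≤-reflexive (sym (+-assoc m (offset bs i) (width bs i)))))

earlier-block-ends-first : ∀ L (s t : Fin (length L)) → toℕ s < toℕ t → offset L s + width L s ≤ offset L t
earlier-block-ends-first (b ∷ bs) zero    (suc t) _ = m≤m+n (proj₁ b) _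
earlier-block-ends-first (b ∷ bs) (suc s) (suc t) (s≤s s<t) =
  ≤-trans (≤-reflexive (+-assoc (proj₁ b) (offset bs s) (width bs s)))
          (+-monoʳ-≤ (proj₁ b) (earlier-block-ends-first bs s t s<t))

LowerLeft : ∀ {n} → (Fin n → Fin n) → Fin n → Fin n → Set
LowerLeft σ x y = toℕ x < toℕ y × toℕ (σ x) < toℕ (σ y)

earlier-block-lowerLeft : ∀ L (s t : Fin (length L)) {c d} → toℕ s < toℕ t →
  InBlock L s c → InBlock L t d → LowerLeft ⊕[ L ] c d
earlier-block-lowerLeft L s t {c} {d} s<t c∈s d∈t =
  before c d c∈s d∈t , before (⊕[ L ] c) (⊕[ L ] d) (inBlock-⊕ L s c c∈s) (inBlock-⊕ L t d d∈t)
  where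
  before : ∀ c d → InBlock L s c → InBlock L t d → toℕ c < toℕ d
  before c d (_ , c<end) (off≤d , _) = <-≤-trans c<end (≤-trans (earlier-block-ends-first L s t s<t) off≤d)

blocks-disjoint : ∀ L s t c → InBlock L s c → InBlock L t c → s ≡ t
blocks-disjoint L s t c c∈s c∈t with <-cmp (toℕ s) (toℕ t)
... | tri< s<t _ _ = ⊥-elim (<-irrefl refl (proj₁ (earlier-block-lowerLeft L s t s<t c∈s c∈t)))
... | tri≈ _ s≡t _ = toℕ-injective s≡t
... | tri> _ _ t<s = ⊥-elim (<-irrefl refl (proj₁ (earlier-block-lowerLeft L t s t<s c∈t c∈s)))

directSum⇒¬indecomposable : ∀ {m m₁ m₂} {σ : Fin m → Fin m} (σ₁ : Fin m₁ → Fin m₁) (σ₂ : Fin m₂ → Fin m₂) →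
  IsNonemptyPerm (m₁ , σ₁) → IsNonemptyPerm (m₂ , σ₂) → m₁ + m₂ ≡ m →
  (∀ x v → toℕ x ≡ toℕ v → toℕ (σ x) ≡ toℕ (σ₁ v)) →
  (∀ x u → toℕ x ≡ m₁ + toℕ u → toℕ (σ x) ≡ m₁ + toℕ (σ₂ u)) →
  ¬ IsOplusIndecomposable σ
directSum⇒¬indecomposable {m₁ = m₁} {m₂} {σ} σ₁ σ₂ σ₁-perm σ₂-perm m₁+m₂≡m on-σ₁ on-σ₂ indecomposable =
  indecomposable (L₂ , s≤s (s≤s z≤n) , σ₁-perm ∷ σ₂-perm ∷ [] , size≡ ,
                  λ x → agrees x (cast (sym size≡) x) (toℕ-cast (sym size≡) x))
  where
  L₂ : List Block
  L₂ = (m₁ , σ₁) ∷ (m₂ , σ₂) ∷ []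
  size≡ : size L₂ ≡ _
  size≡ = trans (cong (m₁ +_) (+-identityʳ m₂)) m₁+m₂≡m
  agrees : ∀ x (y : Fin (size L₂)) → toℕ y ≡ toℕ x → toℕ (σ x) ≡ toℕ (⊕[ L₂ ] y)
  agrees x y y≡x with ↑-view m₁ y
  ... | inj₁ (v , refl) =
    trans (on-σ₁ x v (trans (sym y≡x) (toℕ-↑ˡ v _))) (sym (toℕ-⊕₂-↑ˡ σ₁ _ v))
  ... | inj₂ (b , refl) with ↑-view m₂ {0} b
  ...   | inj₂ (() , _)
  ...   | inj₁ (u , refl) =
    trans (on-σ₂ x u (trans (sym y≡x) (trans (toℕ-↑ʳ m₁ _) (cong (m₁ +_) (toℕ-↑ˡ u 0)))))
          (sym (trans (toℕ-⊕₂-↑ʳ σ₁ _ (u ↑ˡ 0)) (cong (m₁ +_) (toℕ-⊕₂-↑ˡ σ₂ _ u))))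

prefixSplit⇒¬indecomposable : ∀ {m} {σ : Fin m → Fin m} → IsPerm σ → ∀ {m₁} → 0 < m₁ → m₁ < m →
  (∀ x y → toℕ x < m₁ → m₁ ≤ toℕ y → toℕ (σ x) < toℕ (σ y)) → ¬ IsOplusIndecomposable σ
prefixSplit⇒¬indecomposable {m} {σ} σ-inj {m₁} 0<m₁ m₁<m prefix-below =
  directSum⇒¬indecomposable σ₁ σ₂ (0<m₁ , σ₁-inj) (m<n⇒0<n∸m m₁<m , σ₂-inj) (m+[n∸m]≡n m₁≤m) on-σ₁ on-σ₂
  where
  m₁≤m = <⇒≤ m₁<m
  m₂ = m ∸ m₁

  lower : Fin m₁ → Fin m
  lower v = inject≤ v m₁≤m
  lower<m₁ : ∀ v → toℕ (lower v) < m₁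
  lower<m₁ v = subst (_< m₁) (sym (toℕ-inject≤ v m₁≤m)) (toℕ<n v)

  upper : Fin m₂ → Fin m
  upper u = fromℕ< (subst (m₁ + toℕ u <_) (m+[n∸m]≡n m₁≤m) (+-monoʳ-< m₁ (toℕ<n u)))
  toℕ-upper : ∀ u → toℕ (upper u) ≡ m₁ + toℕ u
  toℕ-upper u = toℕ-fromℕ< _
  m₁≤upper : ∀ u → m₁ ≤ toℕ (upper u)
  m₁≤upper u = subst (m₁ ≤_) (sym (toℕ-upper u)) (m≤m+n m₁ (toℕ u))

  -- the m₁ values σ (lower v) are all below σ y
  upper-value : ∀ y → m₁ ≤ toℕ y → m₁ ≤ toℕ (σ y)
  upper-value y m₁≤y = injective⇒≤ {f = below-σy} λ eq →
    inject≤-injective m₁≤m m₁≤m _ _ (σ-inj (toℕ-injective (fromℕ<-injective _ _ _ _ eq)))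
    where
    below-σy : Fin m₁ → Fin (toℕ (σ y))
    below-σy v = fromℕ< (prefix-below (lower v) y (lower<m₁ v) m₁≤y)

  σ₂ : Fin m₂ → Fin m₂
  σ₂ u = fromℕ< (∸-monoˡ-< (toℕ<n (σ (upper u))) (upper-value (upper u) (m₁≤upper u)))
  toℕ-σ₂ : ∀ u → m₁ + toℕ (σ₂ u) ≡ toℕ (σ (upper u))
  toℕ-σ₂ u = trans (cong (m₁ +_) (toℕ-fromℕ< _)) (m+[n∸m]≡n (upper-value (upper u) (m₁≤upper u)))
  σ₂-inj : IsPerm σ₂
  σ₂-inj {u} {u'} eq = toℕ-injective (+-cancelˡ-≡ m₁ _ _ (begin
    m₁ + toℕ u          ≡⟨ toℕ-upper u ⟨
    toℕ (upper u)       ≡⟨ cong toℕ (σ-inj (toℕ-injective σ-upper≡)) ⟩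
    toℕ (upper u')      ≡⟨ toℕ-upper u' ⟩
    m₁ + toℕ u'         ∎))
    where
    open ≡-Reasoning
    σ-upper≡ : toℕ (σ (upper u)) ≡ toℕ (σ (upper u'))
    σ-upper≡ = trans (sym (toℕ-σ₂ u)) (trans (cong (λ z → m₁ + toℕ z) eq) (toℕ-σ₂ u'))

  -- σ₂ is onto, so every value ≥ m₁ is already taken by an upper column
  lower-value : ∀ x → toℕ x < m₁ → toℕ (σ x) < m₁
  lower-value x x<m₁ with toℕ (σ x) <? m₁
  ... | yes σx<m₁ = σx<m₁
  ... | no σx≮m₁ = ⊥-elim (<⇒≱ x<m₁ (subst (m₁ ≤_) (cong toℕ upper-u≡x) (m₁≤upper u)))
    where
    m₁≤σx = ≮⇒≥ σx≮m₁
    target : Fin m₂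
    target = fromℕ< (∸-monoˡ-< (toℕ<n (σ x)) m₁≤σx)
    u = proj₁ (injective⇒surjective σ₂-inj target)
    upper-u≡x : upper u ≡ x
    upper-u≡x = σ-inj (toℕ-injective (begin
      toℕ (σ (upper u))        ≡⟨ toℕ-σ₂ u ⟨
      m₁ + toℕ (σ₂ u)          ≡⟨ cong (λ z → m₁ + toℕ z) (proj₂ (injective⇒surjective σ₂-inj target)) ⟩
      m₁ + toℕ target          ≡⟨ cong (m₁ +_) (toℕ-fromℕ< _) ⟩
      m₁ + (toℕ (σ x) ∸ m₁)    ≡⟨ m+[n∸m]≡n m₁≤σx ⟩
      toℕ (σ x)                ∎))
      where open ≡-Reasoning

  σ₁ : Fin m₁ → Fin m₁
  σ₁ v = fromℕ< (lower-value (lower v) (lower<m₁ v))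
  σ₁-inj : IsPerm σ₁
  σ₁-inj eq = inject≤-injective m₁≤m m₁≤m _ _ (σ-inj (toℕ-injective (fromℕ<-injective _ _ _ _ eq)))

  on-σ₁ : ∀ x v → toℕ x ≡ toℕ v → toℕ (σ x) ≡ toℕ (σ₁ v)
  on-σ₁ x v x≡v rewrite toℕ-injective (trans x≡v (sym (toℕ-inject≤ v m₁≤m))) = sym (toℕ-fromℕ< _)

  on-σ₂ : ∀ x u → toℕ x ≡ m₁ + toℕ u → toℕ (σ x) ≡ m₁ + toℕ (σ₂ u)
  on-σ₂ x u x≡ rewrite toℕ-injective (trans x≡ (sym (toℕ-upper u))) = sym (toℕ-σ₂ u)

lowerLeftSplit⇒¬indecomposable : ∀ {m} {σ : Fin m → Fin m} → IsPerm σ →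
  (S : Fin m → Set) → Decidable S → ∃ S → ∃ (λ y → ¬ S y) →
  (∀ x y → S x → ¬ S y → LowerLeft σ x y) → ¬ IsOplusIndecomposable σ
lowerLeftSplit⇒¬indecomposable {m} σ-inj S S? (x₀ , Sx₀) (y₀ , ¬Sy₀) split =
  prefixSplit⇒¬indecomposable σ-inj (s≤s z≤n) m₁<m
    (λ x y x<m₁ m₁≤y → proj₂ (split x y (prefix x x<m₁) (suffix y m₁≤y)))
  where
  top = greatest S S? (x₀ , Sx₀)
  last = proj₁ top
  S-last = proj₁ (proj₂ top)
  m₁ = suc (toℕ last)
  m₁<m : m₁ < m
  m₁<m = ≤-<-trans (proj₁ (split last y₀ S-last ¬Sy₀)) (toℕ<n y₀)
  suffix : ∀ y → m₁ ≤ toℕ y → ¬ S y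
  suffix y m₁≤y Sy = ≤⇒≯ (proj₂ (proj₂ top) y Sy) m₁≤y
  prefix : ∀ x → toℕ x < m₁ → S x
  prefix x x<m₁ with S? x
  ... | yes Sx = Sx
  ... | no ¬Sx = ⊥-elim (≤⇒≯ (s≤s⁻¹ x<m₁) (proj₁ (split last x S-last ¬Sx)))

blockSplit⇒¬indecomposable : ∀ L u → IsPerm (block L u) →
  (S : Fin (size L) → Set) → Decidable S →
  (∃ λ c → InBlock L u c × S c) → (∃ λ d → InBlock L u d × ¬ S d) →
  (∀ c d → InBlock L u c → InBlock L u d → S c → ¬ S d → LowerLeft ⊕[ L ] c d) →
  ¬ IsOplusIndecomposable (block L u)
blockSplit⇒¬indecomposable L u perm S S? (c , c∈u , Sc) (d , d∈u , ¬Sd) split =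
  lowerLeftSplit⇒¬indecomposable perm (λ x → S (column L u x)) (λ x → S? (column L u x))
    (inBlock-local c c∈u Sc) (inBlock-local d d∈u ¬Sd) local-split
  where
  inBlock-local : ∀ {P : Fin (size L) → Set} c → InBlock L u c → P c → ∃ λ x → P (column L u x)
  inBlock-local c c∈u Pc with inBlock⇒column L u c c∈u
  ... | x , refl = x , Pc
  local-split : ∀ x y → S (column L u x) → ¬ S (column L u y) → LowerLeft (block L u) x y
  local-split x y Sx ¬Sy with split _ _ (inBlock-column L u x) (inBlock-column L u y) Sx ¬Sy
  ... | columns< , values< =
    +-cancelˡ-< (offset L u) _ _ (subst₂ _<_ (toℕ-column L u x) (toℕ-column L u y) columns<) ,
    +-cancelˡ-< (offset L u) _ _ (subst₂ _<_ (toℕ-⊕-column L u x) (toℕ-⊕-column L u y) values<)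

-- The pin conditions of Defs over an arbitrary order on the coordinates; reversing the order
-- (isPinSequence-flip) turns the diagram by a half turn, which gives the mirror-image case below.
module PinSequence {A : Set} (_⊏_ : A → A → Set) {n : ℕ} (X Y : Fin n → A) where

  _≺_ : Fin n → Fin n → Set
  j ≺ l = X j ⊏ X l × Y j ⊏ Y l

  OutsideBox : Fin n → Set
  OutsideBox i =
      (∀ j → toℕ j < toℕ i → X i ⊏ X j)
    ⊎ (∀ j → toℕ j < toℕ i → X j ⊏ X i)
    ⊎ (∀ j → toℕ j < toℕ i → Y i ⊏ Y j)
    ⊎ (∀ j → toℕ j < toℕ i → Y j ⊏ Y i)

  Separates : Fin n → Fin n → Set
  Separates i i' =
      (X i' ⊏ X i × (∀ j → toℕ j < toℕ i' → X i ⊏ X j))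
    ⊎ (X i ⊏ X i' × (∀ j → toℕ j < toℕ i' → X j ⊏ X i))
    ⊎ (Y i' ⊏ Y i × (∀ j → toℕ j < toℕ i' → Y i ⊏ Y j))
    ⊎ (Y i ⊏ Y i' × (∀ j → toℕ j < toℕ i' → Y j ⊏ Y i))

  DoesNotSeparate : Fin n → Set
  DoesNotSeparate i =
      ((∀ j → toℕ j < toℕ i → X j ⊏ X i) ⊎ (∀ j → toℕ j < toℕ i → X i ⊏ X j))
    × ((∀ j → toℕ j < toℕ i → Y j ⊏ Y i) ⊎ (∀ j → toℕ j < toℕ i → Y i ⊏ Y j))

  IsPinSequence : Set
  IsPinSequence = ∀ i i' → toℕ i ≡ suc (toℕ i') → OutsideBox i × (Separates i i' ⊎ DoesNotSeparate i)

  UpperRightRun : Fin n → Fin n → Set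
  UpperRightRun i₀ i = ∀ j l → toℕ j < toℕ i₀ → toℕ i₀ ≤ toℕ l → toℕ l ≤ toℕ i → j ≺ l

  RunAfter : Fin n → Fin n → Set
  RunAfter e i = ∃ λ i₀ → toℕ e < toℕ i₀ × toℕ i₀ ≤ toℕ i × UpperRightRun i₀ i

  run-start : ∀ {i} → (∀ j → toℕ j < toℕ i → j ≺ i) → UpperRightRun i i
  run-start {i} all≺i j l j<i i≤l l≤i = subst (j ≺_) (toℕ-injective (≤-antisym i≤l l≤i)) (all≺i j j<i)

  run-extend : ∀ {i₀ i i'} → toℕ i ≡ suc (toℕ i') → toℕ i₀ ≤ toℕ i' → UpperRightRun i₀ i' →
    (∀ j → toℕ j < toℕ i' → j ≺ i) → UpperRightRun i₀ i
  run-extend {i₀} {i} {i'} i≡1+i' i₀≤i' run all≺i j l j<i₀ i₀≤l l≤i with toℕ l ≤? toℕ i'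
  ... | yes l≤i' = run j l j<i₀ i₀≤l l≤i'
  ... | no l≰i' = subst (j ≺_) (toℕ-injective (≤-antisym (subst (_≤ toℕ l) (sym i≡1+i') (≰⇒> l≰i')) l≤i))
                        (all≺i j (<-≤-trans j<i₀ i₀≤i'))

  module _ (asym : Asymmetric _⊏_) (pin : IsPinSequence)
           (F : Fin n → Set) (F? : Decidable F) (w : Fin n) (w≺F : ∀ j → F j → w ≺ j)
           (comparable : ∀ j l → F l → ¬ F j → j ≺ l ⊎ l ≺ j) where

    pin-step : ∀ i i' → toℕ i ≡ suc (toℕ i') → toℕ w < toℕ i' → F i →
      (∀ j → toℕ j < toℕ i → j ≺ i) ⊎ (F i' × ∀ j → toℕ j < toℕ i' → j ≺ i)
    pin-step i i' i≡1+i' w<i' Fi = step (pin i i' i≡1+i')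
      where
      i'<i : toℕ i' < toℕ i
      i'<i = ≤-reflexive (sym i≡1+i')
      w<i : toℕ w < toℕ i
      w<i = <-trans w<i' i'<i
      ¬leftOfAll : ∀ {k} → toℕ w < toℕ k → ¬ (∀ j → toℕ j < toℕ k → X i ⊏ X j)
      ¬leftOfAll w<k leftOfAll = asym (proj₁ (w≺F i Fi)) (leftOfAll w w<k)
      ¬belowAll : ∀ {k} → toℕ w < toℕ k → ¬ (∀ j → toℕ j < toℕ k → Y i ⊏ Y j)
      ¬belowAll w<k belowAll = asym (proj₂ (w≺F i Fi)) (belowAll w w<k)
      F-i' : ¬ (i' ≺ i) → ¬ (i ≺ i') → F i'
      F-i' ¬i'≺i ¬i≺i' with F? i'
      ... | yes Fi' = Fi'
      ... | no ¬Fi' = ⊥-elim ([ ¬i'≺i , ¬i≺i' ] (comparable i' i Fi ¬Fi'))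
      outside⇒above : OutsideBox i → X i ⊏ X i' → ∀ j → toℕ j < toℕ i → Y j ⊏ Y i
      outside⇒above (inj₁ leftOfAll) _ = ⊥-elim (¬leftOfAll w<i leftOfAll)
      outside⇒above (inj₂ (inj₁ rightOfAll)) i⊏i' = ⊥-elim (asym i⊏i' (rightOfAll i' i'<i))
      outside⇒above (inj₂ (inj₂ (inj₁ belowAll))) _ = ⊥-elim (¬belowAll w<i belowAll)
      outside⇒above (inj₂ (inj₂ (inj₂ aboveAll))) _ = aboveAll
      outside⇒right : OutsideBox i → Y i ⊏ Y i' → ∀ j → toℕ j < toℕ i → X j ⊏ X i
      outside⇒right (inj₁ leftOfAll) _ = ⊥-elim (¬leftOfAll w<i leftOfAll)
      outside⇒right (inj₂ (inj₁ rightOfAll)) _ = rightOfAll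
      outside⇒right (inj₂ (inj₂ (inj₁ belowAll))) _ = ⊥-elim (¬belowAll w<i belowAll)
      outside⇒right (inj₂ (inj₂ (inj₂ aboveAll))) i⊏i' = ⊥-elim (asym i⊏i' (aboveAll i' i'<i))
      step : OutsideBox i × (Separates i i' ⊎ DoesNotSeparate i) →
        (∀ j → toℕ j < toℕ i → j ≺ i) ⊎ (F i' × ∀ j → toℕ j < toℕ i' → j ≺ i)
      step (_ , inj₂ (inj₁ rightOfAll , inj₁ aboveAll)) = inj₁ (λ j j<i → rightOfAll j j<i , aboveAll j j<i)
      step (_ , inj₂ (inj₂ leftOfAll , _)) = ⊥-elim (¬leftOfAll w<i leftOfAll)
      step (_ , inj₂ (_ , inj₂ belowAll)) = ⊥-elim (¬belowAll w<i belowAll)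
      step (_ , inj₁ (inj₁ (_ , leftOfAll))) = ⊥-elim (¬leftOfAll w<i' leftOfAll)
      step (_ , inj₁ (inj₂ (inj₂ (inj₁ (_ , belowAll))))) = ⊥-elim (¬belowAll w<i' belowAll)
      step (outside , inj₁ (inj₂ (inj₁ (i⊏i' , rightOfAll)))) =
        inj₂ (F-i' (λ i'≺i → asym (proj₁ i'≺i) i⊏i') (λ i≺i' → asym (proj₂ i≺i') (above i' i'<i)) ,
              λ j j<i' → rightOfAll j j<i' , above j (<-trans j<i' i'<i))
        where above = outside⇒above outside i⊏i'
      step (outside , inj₁ (inj₂ (inj₂ (inj₂ (i⊏i' , aboveAll))))) =
        inj₂ (F-i' (λ i'≺i → asym (proj₂ i'≺i) i⊏i') (λ i≺i' → asym (proj₁ i≺i') (right i' i'<i)) ,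
              λ j j<i' → right j (<-trans j<i' i'<i) , aboveAll j j<i')
        where right = outside⇒right outside i⊏i'

    ∃-upperRightRun : ∀ e → ¬ F e → toℕ w < toℕ e → ∀ i → toℕ e < toℕ i → F i → RunAfter e i
    ∃-upperRightRun e ¬Fe w<e i = go i (<-wellFounded i)
      where
      go : ∀ i → Acc Fin._<_ i → toℕ e < toℕ i → F i → RunAfter e i
      go i (acc earlier) e<i Fi = continue (pin-step i i' i≡1+i' (<-≤-trans w<e e≤i') Fi)
        where
        i' = proj₁ (predecessor i (≤-<-trans z≤n e<i))
        i≡1+i' = proj₂ (predecessor i (≤-<-trans z≤n e<i))
        i'<i : toℕ i' < toℕ i
        i'<i = ≤-reflexive (sym i≡1+i')
        e≤i' : toℕ e ≤ toℕ i'
        e≤i' = s≤s⁻¹ (subst (toℕ e <_) i≡1+i' e<i)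
        continue : (∀ j → toℕ j < toℕ i → j ≺ i) ⊎ (F i' × ∀ j → toℕ j < toℕ i' → j ≺ i) →
          RunAfter e i
        continue (inj₁ all≺i) = i , e<i , ≤-refl , run-start all≺i
        continue (inj₂ (Fi' , all≺i)) with go i' (earlier i'<i) e<i' Fi'
          where
          e<i' : toℕ e < toℕ i'
          e<i' = ≤∧≢⇒< e≤i' (λ e≡i' → ¬Fe (subst F (sym (toℕ-injective e≡i')) Fi'))
        ... | i₀ , e<i₀ , i₀≤i' , run =
          i₀ , e<i₀ , ≤-trans i₀≤i' (<⇒≤ i'<i) , run-extend i≡1+i' i₀≤i' run all≺i

isPinSequence-flip : ∀ {n} {X Y : Fin n → ℕ} →
  PinSequence.IsPinSequence _<_ X Y → PinSequence.IsPinSequence _>_ X Y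
isPinSequence-flip pin i i' i≡1+i' with pin i i' i≡1+i'
... | outside , separation = swap₄ outside , Sum.map swap₄ (Product.map swap swap) separation
  where
  swap₄ : ∀ {A B C D : Set} → A ⊎ B ⊎ C ⊎ D → B ⊎ A ⊎ D ⊎ C
  swap₄ (inj₁ a) = inj₂ (inj₁ a)
  swap₄ (inj₂ (inj₁ b)) = inj₁ b
  swap₄ (inj₂ (inj₂ (inj₁ c))) = inj₂ (inj₂ (inj₂ c))
  swap₄ (inj₂ (inj₂ (inj₂ d))) = inj₂ (inj₂ (inj₁ d))

module _ (L : List Block)
         (blocks : All (λ b → IsNonemptyPerm b × IsOplusIndecomposable (proj₂ b)) L)
         (p : Fin (size L) → Fin (size L)) (p-pin : IsPinRepresentation ⊕[ L ] p) where

  private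
    π = ⊕[ L ]
    open PinSequence _<_ (X π p) (Y π p) using (_≺_; ∃-upperRightRun)
    module Dual = PinSequence _>_ (X π p) (Y π p)

    PinIn : Fin (length L) → Fin (size L) → Set
    PinIn u j = InBlock L u (p j)

    pinIn? : ∀ u → Decidable (PinIn u)
    pinIn? u j = (offset L u ≤? toℕ (p j)) ×-dec (toℕ (p j) <? offset L u + width L u)

    pinIn-comparable : ∀ u j l → PinIn u l → ¬ PinIn u j → j ≺ l ⊎ l ≺ j
    pinIn-comparable u j l l∈u j∉u with inSomeBlock L (p j)
    ... | v , j∈v with <-cmp (toℕ v) (toℕ u)
    ...   | tri< v<u _ _ = inj₁ (earlier-block-lowerLeft L v u v<u j∈v l∈u)
    ...   | tri≈ _ v≡u _ = ⊥-elim (j∉u (subst (λ z → PinIn z j) (toℕ-injective v≡u) j∈v))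
    ...   | tri> _ _ u<v = inj₂ (earlier-block-lowerLeft L u v u<v l∈u j∈v)

    p⁻¹ : Fin (size L) → Fin (size L)
    p⁻¹ c = proj₁ (injective⇒surjective (proj₁ p-pin) c)

    p-p⁻¹ : ∀ c → p (p⁻¹ c) ≡ c
    p-p⁻¹ c = proj₂ (injective⇒surjective (proj₁ p-pin) c)

    p⁻¹-p : ∀ j → p⁻¹ (p j) ≡ j
    p⁻¹-p j = proj₁ p-pin (p-p⁻¹ (p j))

    ¬pinSplit : ∀ u (S : Fin (size L) → Set) → Decidable S →
      (∃ λ j → PinIn u j × S j) → (∃ λ l → PinIn u l × ¬ S l) →
      (∀ j l → PinIn u j → PinIn u l → S j → ¬ S l → j ≺ l) → ⊥
    ¬pinSplit u S S? (j , j∈u , Sj) (l , l∈u , ¬Sl) split =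
      blockSplit⇒¬indecomposable L u (proj₂ (proj₁ block-u)) (λ c → S (p⁻¹ c)) (λ c → S? (p⁻¹ c))
        (p j , j∈u , subst S (sym (p⁻¹-p j)) Sj) (p l , l∈u , λ S-l → ¬Sl (subst S (p⁻¹-p l) S-l))
        (λ c d c∈u d∈u Sc ¬Sd → subst₂ (LowerLeft π) (p-p⁻¹ c) (p-p⁻¹ d)
          (split _ _ (subst (InBlock L u) (sym (p-p⁻¹ c)) c∈u) (subst (InBlock L u) (sym (p-p⁻¹ d)) d∈u) Sc ¬Sd))
        (proj₂ block-u)
      where
      block-u = All.lookup blocks (∈-lookup u)

  no-two-straddling : ∀ k s t → toℕ s < toℕ t → Straddles L p k s → Straddles L p k t → ⊥
  no-two-straddling k s t s<t ((a , a<k , a∈s) , (a' , k≤a' , a'∈s)) ((b , b<k , b∈t) , (b' , k≤b' , b'∈t)) =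
    compareLast (<-cmp (toℕ ls) (toℕ lt))
    where
    lastOf-s = greatest (PinIn s) (pinIn? s) (a' , a'∈s)
    lastOf-t = greatest (PinIn t) (pinIn? t) (b' , b'∈t)
    ls = proj₁ lastOf-s
    lt = proj₁ lastOf-t
    ls∈s = proj₁ (proj₂ lastOf-s)
    lt∈t = proj₁ (proj₂ lastOf-t)
    ls-max = proj₂ (proj₂ lastOf-s)
    lt-max = proj₂ (proj₂ lastOf-t)
    k≤ls = ≤-trans k≤a' (ls-max a' a'∈s)
    k≤lt = ≤-trans k≤b' (lt-max b' b'∈t)

    s-pin∉t : ∀ j → PinIn s j → ¬ PinIn t j
    s-pin∉t j j∈s j∈t = <-irrefl (cong toℕ (blocks-disjoint L s t (p j) j∈s j∈t)) s<t

    compareLast : Tri (toℕ ls < toℕ lt) (toℕ ls ≡ toℕ lt) (toℕ ls > toℕ lt) → ⊥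
    compareLast (tri≈ _ ls≡lt _) = s-pin∉t ls ls∈s (subst (PinIn t) (sym (toℕ-injective ls≡lt)) lt∈t)
    compareLast (tri< ls<lt _ _)
      with ∃-upperRightRun <-asym (proj₂ p-pin) (PinIn t) (pinIn? t)
             a (λ j j∈t → earlier-block-lowerLeft L s t s<t a∈s j∈t) (pinIn-comparable t)
             ls (s-pin∉t ls ls∈s) (<-≤-trans a<k k≤ls) lt ls<lt lt∈t
    ... | i₀ , ls<i₀ , i₀≤lt , run =
      ¬pinSplit t (λ j → toℕ j < toℕ i₀) (λ j → toℕ j <? toℕ i₀)
        (b , b∈t , <-trans (<-≤-trans b<k k≤ls) ls<i₀) (lt , lt∈t , ≤⇒≯ i₀≤lt)
        (λ j l _ l∈t j<i₀ l≮i₀ → run j l j<i₀ (≮⇒≥ l≮i₀) (lt-max l l∈t))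
    compareLast (tri> _ _ lt<ls)
      with Dual.∃-upperRightRun <-asym (isPinSequence-flip (proj₂ p-pin)) (PinIn s) (pinIn? s)
             b (λ j j∈s → earlier-block-lowerLeft L s t s<t j∈s b∈t)
             (λ j l l∈s j∉s → swap (pinIn-comparable s j l l∈s j∉s))
             lt (λ lt∈s → s-pin∉t lt lt∈s lt∈t) (<-≤-trans b<k k≤lt) ls lt<ls ls∈s
    ... | i₀ , lt<i₀ , i₀≤ls , run =
      ¬pinSplit s (λ j → toℕ i₀ ≤ toℕ j) (λ j → toℕ i₀ ≤? toℕ j)
        (ls , ls∈s , i₀≤ls) (a , a∈s , <⇒≱ (<-trans (<-≤-trans a<k k≤lt) lt<i₀))
        (λ j l j∈s _ i₀≤j i₀≰l → run l j (≰⇒> i₀≰l) i₀≤j (ls-max j j∈s))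

lemmaB4 : (L : List Block) → 2 ≤ length L →
    All (λ b → IsNonemptyPerm b × IsOplusIndecomposable (Data.Product.proj₂ b)) L →
    IsPinPermutation ⊕[ L ] →
    (p : Fin (size L) → Fin (size L)) → IsPinRepresentation ⊕[ L ] p →
    (k : ℕ) → 1 ≤ k → k ≤ size L →
    (i i' : Fin (length L)) → Straddles L p k i → Straddles L p k i' → i ≡ i'
lemmaB4 L _ blocks _ p p-pin k _ _ i i' i-straddles i'-straddles with <-cmp (toℕ i) (toℕ i')
... | tri< i<i' _ _ = ⊥-elim (no-two-straddling L blocks p p-pin k i i' i<i' i-straddles i'-straddles)
... | tri≈ _ i≡i' _ = toℕ-injective i≡i'
... | tri> _ _ i'<i = ⊥-elim (no-two-straddling L blocks p p-pin k i' i i'<i i'-straddles i-straddles)
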